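{- Let $\omega$ be a finite permutation of length $l\ge 1$ with natural word $\eta=\eta_1\eta_2\cdots\eta_l$, and let $\mathcal U$ be the tower diagram obtained from $\varnothing$ by successively sliding $\eta_l,\eta_{l-1},\dots,\eta_1$ (the reversed word). Then $\mathcal U$ has no cell in tower $\eta_l+1$, i.e. $(\eta_l+1,0)\notin\mathcal U$.
   Context: $s_i=(i,i+1)$; permutations compose as functions; a reduced word of $\omega$ is a word $\alpha_1\cdots\alpha_\ell$ with $\omega=s_{\alpha_1}\cdots s_{\alpha_\ell}$ and $\ell=\ell(\omega)$ minimal. A cell is a pair $(i,j)$ of integers with $i\ge 1$, $j\ge 0$. A tower diagram is a finite set $\mathcal T$ of cells such that $(i,j)\in\mathcal T$ and $0\le k\le j$ imply $(i,k)\in\mathcal T$; its $i$-th tower consists of its cells with first coordinate $i$. The cell $(i,j)$ lies on the diagonal $x+y=i+j$. Flight paths (recursive): a cell $(i,j)\in\mathcal T$ has a flight path in $\mathcal T$ if either (F1) there is no cell $(i',j')\in\mathcal T$ with $i'<i$ and $i'+j'=i+j-1$ (flight path $\{(i,j)\}$), or (F2) such cells exist and, letting $(i',j')$ be the one with largest $i'$, $(i',j')$ has a flight path and $(i',j'+1)\in\mathcal T$ (flight path $\{(i,j),(i',j'+1)\}\cup\mathrm{flightpath}((i',j'),\mathcal T)$). The flight number of such a cell is $a+b$ for $(a,b)$ the lexicographically smallest element of its flight path. Sliding: for a positive integer $\alpha$, $\alpha^{\searrow}\mathcal T$ is computed by the procedure $P(\gamma,m)$ started at $\gamma=\alpha$,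 $m=1$: (S1) if no cell $(i,j)\in\mathcal T$ with $i\ge m$ lies on $x+y=\gamma-1$: (a) if $(\gamma,0)\notin\mathcal T$ the result is $\mathcal T\cup\{(\gamma,0)\}$; (b) if $(\gamma,0)\in\mathcal T$, $(\gamma,1)\notin\mathcal T$ the slide terminates (without result); (c) if $(\gamma,0),(\gamma,1)\in\mathcal T$, continue with $P(\gamma+1,\gamma+1)$. (S2) Otherwise let $i\ge m$ be smallest with $(i,\gamma-1-i)\in\mathcal T$: (a) if $(i,\gamma-i)\notin\mathcal T$ the result is $\mathcal T\cup\{(i,\gamma-i)\}$; (b) if $(i,\gamma-i)\in\mathcal T$, $(i,\gamma-i+1)\notin\mathcal T$ the slide terminates; (c) if both are in $\mathcal T$, continue with $P(\gamma+1,i+1)$. The tower diagram $\mathcal T_\omega$ of $\omega$ is obtained from $\varnothing$ by successively sliding the letters of any reduced word of $\omega$ (independent of the choice). The natural labelling of $\mathcal T_\omega$ (with $n$ cells) labels the cells $1,\dots,n$ starting with the rightmost nonempty tower from bottom to top, then the next nonempty tower to its left from bottom to top, and so on. The natural word $\eta$ of $\omega$ is the reading word of this labelling: its $k$-th letter is the flight number of the cell labelled $k$ in the diagram formed by the cells labelled $1,\dots,k$. Equivalently, if the nonempty towers of $\mathcal T_\omega$ are at positions $i_1>i_2>\dots>i_s$ with heights $h_1,\dots,h_s$, then $\eta=(i_1,i_1+1,\dots,i_1+h_1-1)(i_2,\dots,i_2+h_2-1)\cdots(i_s,\dots,i_s+h_s-1)$; it is a reduced word of $\omega$. -}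

module Defs where

open import Data.Nat using (ℕ; zero; suc; _+_; _∸_; _≤_; _<_; _<ᵇ_; _≡ᵇ_)
open import Data.Nat.Properties using (_≟_; _<?_)
open import Data.Bool using (Bool; true; false; if_then_else_)
open import Data.List using (List; []; _∷_; length; concat; reverse; _++_)
open import Data.Nat.ListAction using (sum)
open import Data.List.Relation.Unary.All using (All)
open import Data.Maybe using (Maybe; just; nothing; _>>=_)
open import Data.Product using (_×_; _,_)
open import Relation.Binary.PropositionalEquality using (_≡_)

-- Permutations of the positive integers given by words.
-- s_a = (a, a+1); words compose as functions:
--   ⟦ a₁ ∷ a₂ ∷ … ⟧ = s_{a₁} ∘ s_{a₂} ∘ …

swap : ℕ → ℕ → ℕ
swap a k = if k ≡ᵇ a then suc a else (if k ≡ᵇ suc a then a else k)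

⟦_⟧ : List ℕ → ℕ → ℕ
⟦ [] ⟧ k = k
⟦ a ∷ w ⟧ k = swap a (⟦ w ⟧ k)

-- a word in the letters 1,2,3,... (s_i is only defined for i ≥ 1)
IsWord : List ℕ → Set
IsWord w = All (1 ≤_) w

Represents : List ℕ → (ℕ → ℕ) → Set
Represents w ω = IsWord w × (∀ k → 1 ≤ k → ⟦ w ⟧ k ≡ ω k)

IsReducedWordOf : List ℕ → (ℕ → ℕ) → Set
IsReducedWordOf w ω =
  Represents w ω × (∀ v → Represents v ω → length w ≤ length v)

-- Tower diagrams, encoded by their tower heights:
-- the list  h₁ ∷ h₂ ∷ … ∷ h_L  means tower i has height hᵢ
-- (i.e. cells (i,0),…,(i,hᵢ-1)), towers beyond L are empty.

Tower : Set
Tower = List ℕ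

-- height of the i-th tower (i ≥ 1); 0 for i = 0 or beyond the list
height : Tower → ℕ → ℕ
height T zero = 0
height [] (suc i) = 0
height (h ∷ T) (suc zero) = h
height (h ∷ T) (suc (suc i)) = height T (suc i)

_∈ᶜ_ : ℕ × ℕ → Tower → Set
(i , j) ∈ᶜ T = (1 ≤ i) × (j < height T i)

incr : Tower → ℕ → Tower
incr T zero = T
incr [] (suc zero) = 1 ∷ []
incr [] (suc (suc i)) = 0 ∷ incr [] (suc i)
incr (h ∷ T) (suc zero) = suc h ∷ T
incr (h ∷ T) (suc (suc i)) = h ∷ incr T (suc i)

memᵇ : Tower → ℕ → ℕ → Bool
memᵇ T zero j = false
memᵇ T (suc i) j = j <ᵇ height T (suc i)

-- smallest i with m ≤ i ≤ γ-1 and (i, γ-1-i) ∈ T  (k = number of candidates left)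
firstOnDiag : Tower → ℕ → ℕ → ℕ → Maybe ℕ
firstOnDiag T γ i zero = nothing
firstOnDiag T γ i (suc k) =
  if memᵇ T i (γ ∸ 1 ∸ i) then just i else firstOnDiag T γ (suc i) k

-- the procedure P(γ, m), with a fuel argument guaranteeing termination.
-- Result: just T' (the slide produced T') or nothing (the slide
-- terminated without result).
P : ℕ → Tower → ℕ → ℕ → Maybe Tower
P zero T γ m = nothing
P (suc fuel) T γ m with firstOnDiag T γ m (γ ∸ m)
... | nothing =
  if memᵇ T γ 0
  then (if memᵇ T γ 1
        then P fuel T (suc γ) (suc γ)
        else nothing)
  else just (incr T γ)
... | just i =
  if memᵇ T i (γ ∸ i)
  then (if memᵇ T i (suc (γ ∸ i))
        then P fuel T (suc γ) (suc i)
        else nothing)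
  else just (incr T i)

-- enough fuel: every step increases γ by one, and once
-- γ ≥ (#towers) + (max height) + 2 the case (S1a) applies.
fuelFor : ℕ → Tower → ℕ
fuelFor α T = α + length T + sum T + 3

slide : ℕ → Tower → Maybe Tower
slide α T = P (fuelFor α T) T α 1

slideFrom : Tower → List ℕ → Maybe Tower
slideFrom T [] = just T
slideFrom T (a ∷ w) = slide a T >>= λ T′ → slideFrom T′ w

slideWord : List ℕ → Maybe Tower
slideWord w = slideFrom [] w

-- Natural word of a tower diagram:
-- η = (i₁, …, i₁+h₁-1)(i₂, …, i₂+h₂-1)⋯ for the nonempty towers at
-- positions i₁ > i₂ > ⋯ with heights h₁, h₂, ….

range : ℕ → ℕ → List ℕ
range i zero = []
range i (suc h) = i ∷ range (suc i) h

blocks : ℕ → Tower → List (List ℕ)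
blocks i [] = []
blocks i (h ∷ T) = range i h ∷ blocks (suc i) T

naturalWord : Tower → List ℕ
naturalWord T = concat (reverse (blocks 1 T))

-- The reversed natural word starts with the leftmost nonempty tower read from the top,
-- e = i+h-1, …, i+1, i, and sliding these letters onto ∅ builds single cells in towers
-- i, …, e, each slide landing in case (S1a) because everything to its left is empty.
-- Every later letter exceeds i, and such a slide never adds a cell to tower e+1: it
-- either puts a cell on top of a cell it found on the diagonal (so in a nonempty tower),
-- or adds (γ,0) after finding no cell of the diagonal x+y = γ-1 in towers ≥ m, which is
-- impossible for i < γ ≤ e+1 since (γ-1,0) is such a cell. Hence tower e+1 stays empty.
module Submission where

open import Defs
open import Data.Nat using (ℕ; zero; suc; _+_; _∸_; _≤_; _<_; z≤n; s≤s; s≤s⁻¹; z<s; _≤?_)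
open import Data.Nat.Properties
open import Data.Nat.ListAction using (sum)
open import Data.Bool using (true; false)
open import Data.List using (List; []; _∷_; _++_; _∷ʳ_; [_]; length; reverse; concat; map)
open import Data.List.Properties using (reverse-++; concat-++; ++-identityʳ; unfold-reverse; ∷-injectiveˡ)
open import Data.List.Relation.Unary.All using (All; []; _∷_)
open import Data.List.Relation.Unary.All.Properties using (map⁺; concat⁺)
open import Data.List.Relation.Binary.Permutation.Propositional using (↭-sym)
open import Data.List.Relation.Binary.Permutation.Propositional.Properties using (All-resp-↭; ↭-reverse)
open import Data.Maybe using (just; nothing; _>>=_)
open import Data.Maybe.Properties using (just-injective)
open import Data.Product using (Σ-syntax; _×_; _,_; proj₁; proj₂)
open import Function using (_∘_)
open import Relation.Binary.PropositionalEquality using (_≡_; _≢_; refl; sym; trans; cong; subst; module ≡-Reasoning)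
open import Relation.Nullary using (¬_; yes; no; contradiction)

height-[] : ∀ i → height [] i ≡ 0
height-[] zero = refl
height-[] (suc i) = refl

height-incr-≤ : ∀ T i j → height T j ≤ height (incr T i) j
height-incr-≤ T zero j = ≤-refl
height-incr-≤ T (suc i) zero = z≤n
height-incr-≤ [] (suc i) (suc j) = z≤n
height-incr-≤ (h ∷ T) (suc zero) (suc zero) = n≤1+n h
height-incr-≤ (h ∷ T) (suc zero) (suc (suc j)) = ≤-refl
height-incr-≤ (h ∷ T) (suc (suc i)) (suc zero) = ≤-refl
height-incr-≤ (h ∷ T) (suc (suc i)) (suc (suc j)) = height-incr-≤ T (suc i) (suc j)

height-incr-≢ : ∀ T {i j} → i ≢ j → height (incr T i) j ≡ height T j
height-incr-≢ T {zero} i≢j = refl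
height-incr-≢ T {suc i} {zero} i≢j = refl
height-incr-≢ [] {suc zero} {suc zero} i≢j = contradiction refl i≢j
height-incr-≢ [] {suc zero} {suc (suc j)} i≢j = refl
height-incr-≢ [] {suc (suc i)} {suc zero} i≢j = refl
height-incr-≢ [] {suc (suc i)} {suc (suc j)} i≢j = height-incr-≢ [] (λ e → i≢j (cong suc e))
height-incr-≢ (h ∷ T) {suc zero} {suc zero} i≢j = contradiction refl i≢j
height-incr-≢ (h ∷ T) {suc zero} {suc (suc j)} i≢j = refl
height-incr-≢ (h ∷ T) {suc (suc i)} {suc zero} i≢j = refl
height-incr-≢ (h ∷ T) {suc (suc i)} {suc (suc j)} i≢j = height-incr-≢ T (λ e → i≢j (cong suc e))

height-incr-pos : ∀ T i → 1 ≤ i → 0 < height (incr T i) i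
height-incr-pos [] (suc zero) _ = s≤s z≤n
height-incr-pos [] (suc (suc i)) _ = height-incr-pos [] (suc i) (s≤s z≤n)
height-incr-pos (h ∷ T) (suc zero) _ = s≤s z≤n
height-incr-pos (h ∷ T) (suc (suc i)) _ = height-incr-pos T (suc i) (s≤s z≤n)

memᵇ-height≡0 : ∀ T i j → height T i ≡ 0 → memᵇ T i j ≡ false
memᵇ-height≡0 T zero j _ = refl
memᵇ-height≡0 T (suc i) j empty rewrite empty = refl

memᵇ-bottom : ∀ T i → 0 < height T i → memᵇ T i 0 ≡ true
memᵇ-bottom T (suc i) nonempty with height T (suc i) | nonempty
... | suc _ | _ = refl

firstOnDiag-nothing : ∀ T γ i k → firstOnDiag T γ i k ≡ nothing →
  ∀ {j} → i ≤ j → j < i + k → memᵇ T j (γ ∸ 1 ∸ j) ≡ false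
firstOnDiag-nothing T γ i zero _ i≤j j<i+0 =
  contradiction (subst (_ <_) (+-identityʳ i) j<i+0) (≤⇒≯ i≤j)
firstOnDiag-nothing T γ i (suc k) search {j} i≤j j<i+k with memᵇ T i (γ ∸ 1 ∸ i) in here
firstOnDiag-nothing T γ i (suc k) () i≤j j<i+k | true
... | false with i ≟ j
...   | yes refl = here
...   | no i≢j = firstOnDiag-nothing T γ (suc i) k search (≤∧≢⇒< i≤j i≢j)
                   (subst (j <_) (+-suc i k) j<i+k)

firstOnDiag-just : ∀ T γ i k {r} → firstOnDiag T γ i k ≡ just r →
  i ≤ r × r < i + k × memᵇ T r (γ ∸ 1 ∸ r) ≡ true
firstOnDiag-just T γ i zero ()
firstOnDiag-just T γ i (suc k) {r} search with memᵇ T i (γ ∸ 1 ∸ i) in here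
firstOnDiag-just T γ i (suc k) refl | true = ≤-refl , m<m+n i z<s , here
... | false with firstOnDiag-just T γ (suc i) k search
...   | i<r , r<i+k , onDiag = <⇒≤ i<r , subst (r <_) (sym (+-suc i k)) r<i+k , onDiag

firstOnDiag-empty : ∀ T γ i k → (∀ {j} → j < i + k → height T j ≡ 0) →
  firstOnDiag T γ i k ≡ nothing
firstOnDiag-empty T γ i zero _ = refl
firstOnDiag-empty T γ i (suc k) empty
  rewrite memᵇ-height≡0 T i (γ ∸ 1 ∸ i) (empty (m<m+n i z<s)) =
  firstOnDiag-empty T γ (suc i) k (λ {j} j<1+i+k → empty (subst (j <_) (sym (+-suc i k)) j<1+i+k))

firstOnDiag-window-nothing : ∀ T γ m → firstOnDiag T γ m (γ ∸ m) ≡ nothing →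
  ∀ {j} → m ≤ j → j < γ → memᵇ T j (γ ∸ 1 ∸ j) ≡ false
firstOnDiag-window-nothing T γ m search m≤j j<γ =
  firstOnDiag-nothing T γ m (γ ∸ m) search m≤j
    (subst (_ <_) (sym (m+[n∸m]≡n (<⇒≤ (≤-<-trans m≤j j<γ)))) j<γ)

firstOnDiag-window-just : ∀ T γ m {i} → firstOnDiag T γ m (γ ∸ m) ≡ just i →
  m ≤ i × i < γ × memᵇ T i (γ ∸ 1 ∸ i) ≡ true
firstOnDiag-window-just T γ m {i} search with firstOnDiag-just T γ m (γ ∸ m) search
... | m≤i , i<m+γ∸m , onDiag with m ≤? γ
...   | yes m≤γ = m≤i , subst (_ <_) (m+[n∸m]≡n m≤γ) i<m+γ∸m , onDiag
...   | no m≰γ = contradiction i<m (≤⇒≯ m≤i)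
  where
    i<m : i < m
    i<m = subst (_ <_) (trans (cong (m +_) (m≤n⇒m∸n≡0 (<⇒≤ (≰⇒> m≰γ)))) (+-identityʳ m)) i<m+γ∸m

slide-emptyPrefix : ∀ α U → (∀ {j} → j ≤ α → height U j ≡ 0) → slide α U ≡ just (incr U α)
slide-emptyPrefix α U empty
  rewrite +-comm (α + length U + sum U) 3
        | firstOnDiag-empty U α 1 (α ∸ 1) (λ j<1+α∸1 → empty (≤-trans (s≤s⁻¹ j<1+α∸1) (m∸n≤m α 1)))
        | memᵇ-height≡0 U α 0 (empty ≤-refl) = refl

Gapped : ℕ → ℕ → Tower → Set
Gapped a b U = (∀ {y} → a ≤ y → y ≤ b → 0 < height U y) × height U (suc b) ≡ 0

Gapped-incr : ∀ {a b U i} → i ≢ suc b → Gapped a b U → Gapped a b (incr U i)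
Gapped-incr {U = U} {i} i≢1+b (occupied , gap) =
  (λ {y} a≤y y≤b → ≤-trans (occupied a≤y y≤b) (height-incr-≤ U i y)) ,
  trans (height-incr-≢ U i≢1+b) gap

-- The condition on m guarantees that for γ ≤ b+1 the search window m ≤ i < γ contains γ-1.
-- The failing cases (S1b) and (S2b) need no clause, since there `slid : nothing ≡ just U′`.
P-preserves-Gapped : ∀ {a b} fuel U γ m {U′} → Gapped a b U → a < γ → (γ ≤ suc b → m < γ) →
  P fuel U γ m ≡ just U′ → Gapped a b U′
P-preserves-Gapped zero U γ m g a<γ window ()
P-preserves-Gapped (suc fuel) U zero m g () window slid
P-preserves-Gapped {a} {b} (suc fuel) U (suc c) m g a<1+c window slid
  with firstOnDiag U (suc c) m (suc c ∸ m) in search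
... | nothing with suc c ≤? suc b
...   | yes c<1+b = contradiction (trans (sym bottomCell) notOnDiag) λ ()
  where
    bottomCell : memᵇ U c 0 ≡ true
    bottomCell = memᵇ-bottom U c (proj₁ g (s≤s⁻¹ a<1+c) (s≤s⁻¹ c<1+b))
    notOnDiag : memᵇ U c 0 ≡ false
    notOnDiag = subst (λ j → memᵇ U c j ≡ false) (n∸n≡0 c)
      (firstOnDiag-window-nothing U (suc c) m search (s≤s⁻¹ (window c<1+b)) ≤-refl)
...   | no c≮1+b with memᵇ U (suc c) 0 | memᵇ U (suc c) 1
...     | false | _ = subst (Gapped a b) (just-injective slid) (Gapped-incr (c≮1+b ∘ ≤-reflexive) g)
...     | true | true = P-preserves-Gapped fuel U (suc (suc c)) (suc (suc c)) g (m≤n⇒m≤1+n a<1+c)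
                          (λ 2+c≤1+b → contradiction (m≤n⇒m≤1+n (s≤s⁻¹ 2+c≤1+b)) c≮1+b) slid
P-preserves-Gapped {a} {b} (suc fuel) U (suc c) m g a<1+c window slid | just i
  with firstOnDiag-window-just U (suc c) m search
... | m≤i , i<1+c , onDiag with memᵇ U i (suc c ∸ i) | memᵇ U i (suc (suc c ∸ i))
...   | false | _ = subst (Gapped a b) (just-injective slid) (Gapped-incr i≢1+b g)
  where
    i≢1+b : i ≢ suc b
    i≢1+b refl = contradiction (trans (sym onDiag) (memᵇ-height≡0 U (suc b) _ (proj₂ g))) λ ()
...   | true | true = P-preserves-Gapped fuel U (suc (suc c)) (suc i) g (m≤n⇒m≤1+n a<1+c) (λ _ → s≤s i<1+c) slid

slideFrom-preserves-Gapped : ∀ {a b} w U {U′} → 1 ≤ a → All (a <_) w → Gapped a b U →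
  slideFrom U w ≡ just U′ → Gapped a b U′
slideFrom-preserves-Gapped [] U 1≤a [] g refl = g
slideFrom-preserves-Gapped (α ∷ w) U 1≤a (a<α ∷ a<w) g slid with slide α U in slidα
... | just V = slideFrom-preserves-Gapped w V 1≤a a<w
                 (P-preserves-Gapped (fuelFor α U) U α 1 g a<α (λ _ → ≤-<-trans 1≤a a<α) slidα) slid

slideFrom-++ : ∀ U xs ys {U′} → slideFrom U (xs ++ ys) ≡ just U′ →
  Σ[ V ∈ Tower ] slideFrom U xs ≡ just V × slideFrom V ys ≡ just U′
slideFrom-++ U [] ys slid = U , refl , slid
slideFrom-++ U (x ∷ xs) ys slid with slide x U
... | just V = slideFrom-++ V xs ys slid

range-∷ʳ : ∀ a k → range a (suc k) ≡ range a k ∷ʳ (a + k)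
range-∷ʳ a zero = cong [_] (sym (+-identityʳ a))
range-∷ʳ a (suc k) = cong (a ∷_) (trans (range-∷ʳ (suc a) k) (cong (range (suc a) k ∷ʳ_) (sym (+-suc a k))))

reverse-range : ∀ a k → reverse (range a (suc k)) ≡ (a + k) ∷ reverse (range a k)
reverse-range a k = trans (cong reverse (range-∷ʳ a k)) (reverse-++ (range a k) [ a + k ])

slideFrom-descendingRange : ∀ {a b} k {U V} → 1 ≤ a → a + k ≤ suc b →
  (∀ {y} → y < a + k → height U y ≡ 0) → Gapped (a + k) b U →
  slideFrom U (reverse (range a k)) ≡ just V → Gapped a b V
slideFrom-descendingRange {a} {b} zero {U} 1≤a _ _ g refl =
  subst (λ x → Gapped x b U) (+-identityʳ a) g
slideFrom-descendingRange {a} {b} (suc k) {U} {V} 1≤a a+1+k≤1+b empty (occupied , gap) slid =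
  slideFrom-descendingRange k 1≤a (<⇒≤ a+k<1+b) empty′ (occupied′ , gap′) slid′
  where
    open ≡-Reasoning
    ≤⇒<a+1+k : ∀ {y} → y ≤ a + k → y < a + suc k
    ≤⇒<a+1+k {y} y≤a+k = subst (y <_) (sym (+-suc a k)) (s≤s y≤a+k)
    a+k<1+b : a + k < suc b
    a+k<1+b = <-≤-trans (≤⇒<a+1+k ≤-refl) a+1+k≤1+b
    U′ : Tower
    U′ = incr U (a + k)
    empty′ : ∀ {y} → y < a + k → height U′ y ≡ 0
    empty′ y<a+k = trans (height-incr-≢ U (>⇒≢ y<a+k)) (empty (≤⇒<a+1+k (<⇒≤ y<a+k)))
    occupied′ : ∀ {y} → a + k ≤ y → y ≤ b → 0 < height U′ y
    occupied′ {y} a+k≤y y≤b with a + k ≟ y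
    ... | yes refl = height-incr-pos U (a + k) (≤-trans 1≤a (m≤m+n a k))
    ... | no a+k≢y = ≤-trans (occupied (subst (_≤ y) (sym (+-suc a k)) (≤∧≢⇒< a+k≤y a+k≢y)) y≤b)
                             (height-incr-≤ U (a + k) y)
    gap′ : height U′ (suc b) ≡ 0
    gap′ = trans (height-incr-≢ U (<⇒≢ a+k<1+b)) gap
    slid′ : slideFrom U′ (reverse (range a k)) ≡ just V
    slid′ = begin
      slideFrom U′ (reverse (range a k))
        ≡⟨ cong (λ s → s >>= λ T → slideFrom T (reverse (range a k)))
                (slide-emptyPrefix (a + k) U (empty ∘ ≤⇒<a+1+k)) ⟨
      slideFrom U ((a + k) ∷ reverse (range a k))
        ≡⟨ cong (slideFrom U) (reverse-range a k) ⟨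
      slideFrom U (reverse (range a (suc k)))
        ≡⟨ slid ⟩
      just V ∎

reverse-concat-reverse : ∀ {A : Set} (xss : List (List A)) →
  reverse (concat (reverse xss)) ≡ concat (map reverse xss)
reverse-concat-reverse [] = refl
reverse-concat-reverse (xs ∷ xss) = begin
  reverse (concat (reverse (xs ∷ xss)))       ≡⟨ cong (reverse ∘ concat) (unfold-reverse xs xss) ⟩
  reverse (concat (reverse xss ∷ʳ xs))        ≡⟨ cong reverse (concat-++ (reverse xss) [ xs ]) ⟨
  reverse (concat (reverse xss) ++ (xs ++ [])) ≡⟨ cong (λ ys → reverse (concat (reverse xss) ++ ys)) (++-identityʳ xs) ⟩
  reverse (concat (reverse xss) ++ xs)        ≡⟨ reverse-++ (concat (reverse xss)) xs ⟩
  reverse xs ++ reverse (concat (reverse xss)) ≡⟨ cong (reverse xs ++_) (reverse-concat-reverse xss) ⟩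
  concat (map reverse (xs ∷ xss))             ∎
  where open ≡-Reasoning

range-above : ∀ {j} i h → j ≤ i → All (j ≤_) (range i h)
range-above i zero j≤i = []
range-above i (suc h) j≤i = j≤i ∷ range-above (suc i) h (m≤n⇒m≤1+n j≤i)

reversedBlocks-above : ∀ {j} i T → j ≤ i → All (j ≤_) (concat (map reverse (blocks i T)))
reversedBlocks-above i T j≤i = concat⁺ (map⁺ (reversed-above i T j≤i))
  where
    reversed-above : ∀ {j} i T → j ≤ i → All (All (j ≤_) ∘ reverse) (blocks i T)
    reversed-above i [] j≤i = []
    reversed-above i (h ∷ T) j≤i =
      All-resp-↭ (↭-sym (↭-reverse (range i h))) (range-above i h j≤i)
      ∷ reversed-above (suc i) T (m≤n⇒m≤1+n j≤i)

slideWord-reversedBlocks : ∀ i T {e rest U} → 1 ≤ i →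
  concat (map reverse (blocks i T)) ≡ e ∷ rest →
  slideWord (concat (map reverse (blocks i T))) ≡ just U → height U (suc e) ≡ 0
slideWord-reversedBlocks i [] _ () _
slideWord-reversedBlocks i (zero ∷ T) 1≤i word slid =
  slideWord-reversedBlocks (suc i) T (m≤n⇒m≤1+n 1≤i) word slid
slideWord-reversedBlocks i (suc h ∷ T) {e} {U = U} 1≤i word slid
  with slideFrom-++ [] (reverse (range i (suc h))) (concat (map reverse (blocks (suc i) T))) slid
... | V , slidV , slidU = subst (λ x → height U (suc x) ≡ 0) top (proj₂ gappedU)
  where
    later : List ℕ
    later = concat (map reverse (blocks (suc i) T))
    top : i + h ≡ e
    top = ∷-injectiveˡ (trans (cong (_++ later) (sym (reverse-range i h))) word)
    gapped[] : Gapped (i + suc h) (i + h) []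
    gapped[] = (λ {y} i+1+h≤y y≤i+h → contradiction y≤i+h (<⇒≱ (subst (_≤ y) (+-suc i h) i+1+h≤y)))
             , height-[] (suc (i + h))
    gappedV : Gapped i (i + h) V
    gappedV = slideFrom-descendingRange (suc h) 1≤i (≤-reflexive (+-suc i h))
                (λ {y} _ → height-[] y) gapped[] slidV
    gappedU : Gapped i (i + h) U
    gappedU = slideFrom-preserves-Gapped later V 1≤i (reversedBlocks-above (suc i) T ≤-refl) gappedV slidU

lemma7p4 : (ω : ℕ → ℕ) (w : List ℕ) → IsReducedWordOf w ω → 1 ≤ length w →
    (T : Tower) → slideWord w ≡ just T →
    (η′ : List ℕ) (ηₗ : ℕ) → naturalWord T ≡ η′ ∷ʳ ηₗ →
    (U : Tower) → slideWord (reverse (naturalWord T)) ≡ just U →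
    ¬ ((suc ηₗ , 0) ∈ᶜ U)
lemma7p4 _ _ _ _ T _ η′ ηₗ natural U slid (_ , ηₗ+1-nonempty) =
  <⇒≢ ηₗ+1-nonempty (sym (slideWord-reversedBlocks 1 T ≤-refl reversed slid′))
  where
    open ≡-Reasoning
    reverse-natural : reverse (naturalWord T) ≡ concat (map reverse (blocks 1 T))
    reverse-natural = reverse-concat-reverse (blocks 1 T)
    reversed : concat (map reverse (blocks 1 T)) ≡ ηₗ ∷ reverse η′
    reversed = begin
      concat (map reverse (blocks 1 T)) ≡⟨ reverse-natural ⟨
      reverse (naturalWord T)           ≡⟨ cong reverse natural ⟩
      reverse (η′ ∷ʳ ηₗ)                ≡⟨ reverse-++ η′ [ ηₗ ] ⟩
      ηₗ ∷ reverse η′                   ∎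
    slid′ : slideWord (concat (map reverse (blocks 1 T))) ≡ just U
    slid′ = subst (λ v → slideWord v ≡ just U) reverse-natural slid
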